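{- For all integers $n\ge1$ and $1\le l\le n$, $$\sum_{\mathbf p}\frac{p_1p_2\cdots p_l}{L(\mathbf p)R(\mathbf p)}=\frac1n\,e_{l-1}\!\left(\frac{1}{1\cdot2},\frac{1}{2\cdot3},\ldots,\frac{1}{(n-1)\cdot n}\right),$$ where the sum is over all $l$-compositions $\mathbf p=(p_1,\ldots,p_l)$ of $n$, $L(\mathbf p)=p_1(p_1+p_2)\cdots(p_1+\cdots+p_{l-1})\,n$ and $R(\mathbf p)=p_l(p_{l-1}+p_l)\cdots(p_2+\cdots+p_l)\,n$.
   Context: An $l$-composition of $n$ is an ordered list of $l$ positive integers summing to $n$. $e_j(x_1,\ldots,x_k)$ denotes the $j$-th elementary symmetric function of $x_1,\ldots,x_k$ (the coefficient of $X^{k-j}$ in $(X+x_1)\cdots(X+x_k)$), with $e_0=1$. For $l=1$, $L(\mathbf p)=R(\mathbf p)=n$. -}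

module Defs where

open import Data.Nat using (ℕ; zero; suc; _+_; _*_; _∸_)
open import Data.List using (List; []; _∷_; map; concatMap; foldr; reverse; length; applyUpTo)
open import Data.Nat.ListAction using (product)
open import Data.Rational using (ℚ; _/_; 0ℚ; 1ℚ) renaming (_+_ to _+ℚ_; _*_ to _*ℚ_)

compositions : ℕ → ℕ → List (List ℕ)
compositions zero    zero    = [] ∷ []
compositions zero    (suc n) = []
compositions (suc l) n =
  concatMap (λ p → map (p ∷_) (compositions l (n ∸ p))) (applyUpTo suc n)

partialSums : List ℕ → List ℕ
partialSums []       = []
partialSums (x ∷ xs) = x ∷ map (x +_) (partialSums xs)

init : List ℕ → List ℕ
init []           = []
init (x ∷ [])     = []
init (x ∷ y ∷ xs) = x ∷ init (y ∷ xs)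

Lfac : ℕ → List ℕ → ℕ
Lfac n p = product (init (partialSums p)) * n

Rfac : ℕ → List ℕ → ℕ
Rfac n p = Lfac n (reverse p)

-- rational m / k (with k = 0 mapped to 0; never used with k = 0 below)
frac : ℕ → ℕ → ℚ
frac m zero    = 0ℚ
frac m (suc k) = Data.Rational._/_ (Data.Integer.+_ m) (suc k)
  where import Data.Integer

sumℚ : List ℚ → ℚ
sumℚ = foldr _+ℚ_ 0ℚ

esym : ℕ → List ℚ → ℚ
esym zero    xs       = 1ℚ
esym (suc j) []       = 0ℚ
esym (suc j) (x ∷ xs) = (x *ℚ esym j xs) +ℚ esym (suc j) xs

recipList : ℕ → List ℚ
recipList n = applyUpTo (λ i → frac 1 (suc i * suc (suc i))) (n ∸ 1)

summand : ℕ → List ℕ → ℚ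
summand n p = frac (product p) (Lfac n p * Rfac n p)

LHS : ℕ → ℕ → ℚ
LHS n l = sumℚ (map (summand n) (compositions l n))

RHS : ℕ → ℕ → ℚ
RHS n l = frac 1 n *ℚ esym (l ∸ 1) (recipList n)

-- Let n = a + N. Summing p₁⋯p_l / ∏ (a + s_i)(n − a − s_i) over the l-compositions of N, where s_i
-- runs over the proper partial sums, gives shiftedSum a l N, and n² · LHS n l = shiftedSum 0 l n.
-- For l ≥ 1, splitting off the first part p writes shiftedSum a (l + 1) N as the convolution
-- ∑_p p · H(N − p) with H(r) = shiftedSum (n − r) l r / ((n − r) r), so its second difference in N
-- is H(N + 1).
-- The closed form F n j m = ∑_i (m)_{i+1} / (n − 1)_i · β i j obeys the same recurrence with the
-- same initial values: the second difference of (m)_{i+1} is i(i + 1)(m)_{i−1}, and since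
-- i(i + 1) · β i (j + 1) is e_j of a prefix of the reciprocals 1/((k + 1)(k + 2)), summation by
-- parts gives (m + 1)(n − m − 1) · Δ²_m F n (j + 1) m = F n j (m + 1).
-- At m = n every ratio (n)_{i+1} / (n − 1)_i equals n, and the β i j sum to
-- e_j(1/(1·2), …, 1/((n − 1) n)).

module Submission where

open import Defs
open import Data.Nat using (ℕ; _≤_)
open import Relation.Binary.PropositionalEquality using (_≡_)

import Data.Integer as ℤ
import Data.Integer.Properties as ℤ
open import Data.List using (List; []; _∷_; _++_; [_]; _∷ʳ_; map; concatMap; applyUpTo; reverse; length)
import Data.List.Properties as List
open import Data.List.Relation.Unary.All as All using (All; []; _∷_)
import Data.List.Relation.Unary.All.Properties as All
open import Data.Nat as ℕ using (zero; suc; _∸_; _<_; z≤n; s≤s)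
import Data.Nat.Properties as ℕ
import Data.Nat.Tactic.RingSolver as ℕ-Solver
open import Data.Nat.ListAction using (sum; product)
open import Data.Nat.ListAction.Properties using (sum-↭)
open import Data.List.Relation.Binary.Permutation.Propositional.Properties using (↭-reverse)
open import Data.Product using (_×_; _,_; proj₂)
open import Data.Rational using (ℚ; 0ℚ; 1ℚ; _+_; _*_; _-_; fromℚᵘ; toℚᵘ)
open import Data.Rational.Properties as ℚ using (+-*-commutativeRing)
import Data.Rational.Unnormalised as ℚᵘ
import Data.Rational.Unnormalised.Properties as ℚᵘ
open import Function using (_∘_)
open import Level using (0ℓ)
open import Relation.Binary.PropositionalEquality using (refl; sym; trans; cong; cong₂; module ≡-Reasoning)
open import Relation.Nullary.Decidable using (dec⇒maybe)
open import Tactic.RingSolver using (solve-∀)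
open import Tactic.RingSolver.Core.AlmostCommutativeRing using (AlmostCommutativeRing; fromCommutativeRing)

open ≡-Reasoning

-- The exact zero test lets the ring solver cancel constant coefficients such as 1ℚ - 1ℚ.
ℚ-ring : AlmostCommutativeRing 0ℓ 0ℓ
ℚ-ring = fromCommutativeRing +-*-commutativeRing (λ q → dec⇒maybe (0ℚ ℚ.≟ q))

ι : ℕ → ℚ
ι m = frac m 1

-- inv 0 = 0ℚ, inherited from frac.
inv : ℕ → ℚ
inv k = frac 1 k

fromℚᵘ-+ : ∀ p q → fromℚᵘ (p ℚᵘ.+ q) ≡ fromℚᵘ p + fromℚᵘ q
fromℚᵘ-+ p q = ℚ.toℚᵘ-injective (ℚᵘ.≃-trans (ℚ.toℚᵘ-fromℚᵘ (p ℚᵘ.+ q))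
  (ℚᵘ.≃-sym (ℚᵘ.≃-trans (ℚ.toℚᵘ-homo-+ (fromℚᵘ p) (fromℚᵘ q))
    (ℚᵘ.+-cong (ℚ.toℚᵘ-fromℚᵘ p) (ℚ.toℚᵘ-fromℚᵘ q)))))

fromℚᵘ-* : ∀ p q → fromℚᵘ (p ℚᵘ.* q) ≡ fromℚᵘ p * fromℚᵘ q
fromℚᵘ-* p q = ℚ.toℚᵘ-injective (ℚᵘ.≃-trans (ℚ.toℚᵘ-fromℚᵘ (p ℚᵘ.* q))
  (ℚᵘ.≃-sym (ℚᵘ.≃-trans (ℚ.toℚᵘ-homo-* (fromℚᵘ p) (fromℚᵘ q))
    (ℚᵘ.*-cong (ℚ.toℚᵘ-fromℚᵘ p) (ℚ.toℚᵘ-fromℚᵘ q)))))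

ιᵘ : ℕ → ℚᵘ.ℚᵘ
ιᵘ m = ℚᵘ.mkℚᵘ (ℤ.+ m) 0

ι-+ : ∀ a b → ι (a ℕ.+ b) ≡ ι a + ι b
ι-+ a b = trans (ℚ.fromℚᵘ-cong {ιᵘ (a ℕ.+ b)} {ιᵘ a ℚᵘ.+ ιᵘ b} (ℚᵘ.*≡* eq)) (fromℚᵘ-+ (ιᵘ a) (ιᵘ b))
  where
  eq : ℤ.+ (a ℕ.+ b) ℤ.* ℤ.+ 1 ≡ (ℤ.+ a ℤ.* ℤ.+ 1 ℤ.+ ℤ.+ b ℤ.* ℤ.+ 1) ℤ.* ℤ.+ 1
  eq = cong (ℤ._* ℤ.+ 1) (trans (ℤ.pos-+ a b) (sym (cong₂ ℤ._+_ (ℤ.*-identityʳ (ℤ.+ a)) (ℤ.*-identityʳ (ℤ.+ b)))))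

ι-* : ∀ a b → ι (a ℕ.* b) ≡ ι a * ι b
ι-* a b = trans (ℚ.fromℚᵘ-cong {ιᵘ (a ℕ.* b)} {ιᵘ a ℚᵘ.* ιᵘ b} (ℚᵘ.*≡* (cong (ℤ._* ℤ.+ 1) (ℤ.pos-* a b))))
  (fromℚᵘ-* (ιᵘ a) (ιᵘ b))

ι-suc : ∀ m → ι (suc m) ≡ ι m + 1ℚ
ι-suc m = trans (ι-+ 1 m) (ℚ.+-comm 1ℚ (ι m))

ι-∸ : ∀ {a b} → b ≤ a → ι (a ∸ b) ≡ ι a - ι b
ι-∸ {a} {b} b≤a = begin
  ι (a ∸ b)                ≡⟨ add-sub (ι (a ∸ b)) (ι b) ⟩
  ι (a ∸ b) + ι b - ι b    ≡⟨ cong (_- ι b) (sym (ι-+ (a ∸ b) b)) ⟩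
  ι (a ∸ b ℕ.+ b) - ι b    ≡⟨ cong (λ c → ι c - ι b) (ℕ.m∸n+n≡m b≤a) ⟩
  ι a - ι b                ∎
  where
  add-sub : ∀ x y → x ≡ x + y - y
  add-sub = solve-∀ ℚ-ring

frac≡ι*inv : ∀ m k → frac m k ≡ ι m * inv k
frac≡ι*inv m zero    = sym (ℚ.*-zeroʳ (ι m))
frac≡ι*inv m (suc k) =
  trans (ℚ.fromℚᵘ-cong {ℚᵘ.mkℚᵘ (ℤ.+ m) k} {ιᵘ m ℚᵘ.* ℚᵘ.mkℚᵘ (ℤ.+ 1) k} (ℚᵘ.*≡* eq))
    (fromℚᵘ-* (ιᵘ m) (ℚᵘ.mkℚᵘ (ℤ.+ 1) k))
  where
  eq : ℤ.+ m ℤ.* ℤ.+ suc (k ℕ.+ 0) ≡ (ℤ.+ m ℤ.* ℤ.+ 1) ℤ.* ℤ.+ suc k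
  eq rewrite ℕ.+-identityʳ k | ℤ.*-identityʳ (ℤ.+ m) = refl

ι*inv≡1 : ∀ k → 0 < k → ι k * inv k ≡ 1ℚ
ι*inv≡1 (suc k) _ = trans (sym (frac≡ι*inv (suc k) (suc k)))
  (ℚ.fromℚᵘ-cong {ℚᵘ.mkℚᵘ (ℤ.+ suc k) k} {ιᵘ 1} (ℚᵘ.*≡* (cong ℤ.+_ (ℕ.*-comm (suc k) 1))))

inv-* : ∀ a b → inv (a ℕ.* b) ≡ inv a * inv b
inv-* zero    b       = sym (ℚ.*-zeroˡ (inv b))
inv-* (suc a) zero    = trans (cong inv (ℕ.*-zeroʳ a)) (sym (ℚ.*-zeroʳ (inv (suc a))))
inv-* (suc a) (suc b) = begin
  inv ab                                     ≡⟨ sym (ℚ.*-identityʳ (inv ab)) ⟩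
  inv ab * 1ℚ                                ≡⟨ cong (inv ab *_) (sym (cong₂ _*_ (ι*inv≡1 a′ (s≤s z≤n)) (ι*inv≡1 b′ (s≤s z≤n)))) ⟩
  inv ab * ((ι a′ * inv a′) * (ι b′ * inv b′)) ≡⟨ regroup (inv ab) (ι a′) (inv a′) (ι b′) (inv b′) ⟩
  inv ab * (ι a′ * ι b′) * (inv a′ * inv b′) ≡⟨ cong (λ x → inv ab * x * (inv a′ * inv b′)) (sym (ι-* a′ b′)) ⟩
  inv ab * ι ab * (inv a′ * inv b′)          ≡⟨ cong (_* (inv a′ * inv b′)) (trans (ℚ.*-comm (inv ab) (ι ab)) (ι*inv≡1 ab (s≤s z≤n))) ⟩
  1ℚ * (inv a′ * inv b′)                     ≡⟨ ℚ.*-identityˡ (inv a′ * inv b′) ⟩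
  inv a′ * inv b′                            ∎
  where
  a′ = suc a
  b′ = suc b
  ab = a′ ℕ.* b′
  regroup : ∀ x p q r s → x * ((p * q) * (r * s)) ≡ x * (p * r) * (q * s)
  regroup = solve-∀ ℚ-ring

cancel-ι*ι : ∀ a b {x y} → 0 < a → 0 < b → ι a * ι b * x ≡ y → x ≡ inv a * inv b * y
cancel-ι*ι a b {x} 0<a 0<b refl = begin
  x                                       ≡⟨ sym (trans (cong₂ (λ u v → u * v * x) (ι*inv≡1 a 0<a) (ι*inv≡1 b 0<b)) (unit x)) ⟩
  ι a * inv a * (ι b * inv b) * x         ≡⟨ regroup (ι a) (inv a) (ι b) (inv b) x ⟩
  inv a * inv b * (ι a * ι b * x)         ∎
  where
  unit : ∀ x → 1ℚ * 1ℚ * x ≡ x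
  unit = solve-∀ ℚ-ring
  regroup : ∀ a a′ b b′ x → a * a′ * (b * b′) * x ≡ a′ * b′ * (a * b * x)
  regroup = solve-∀ ℚ-ring

-- Finite sums, second differences and convolutions

sumℚ-++ : ∀ xs ys → sumℚ (xs ++ ys) ≡ sumℚ xs + sumℚ ys
sumℚ-++ []       ys = sym (ℚ.+-identityˡ (sumℚ ys))
sumℚ-++ (x ∷ xs) ys = trans (cong (x +_) (sumℚ-++ xs ys)) (sym (ℚ.+-assoc x (sumℚ xs) (sumℚ ys)))

sumℚ-concatMap : ∀ {A B : Set} (f : B → ℚ) (g : A → List B) xs →
                 sumℚ (map f (concatMap g xs)) ≡ sumℚ (map (λ x → sumℚ (map f (g x))) xs)
sumℚ-concatMap f g []       = refl
sumℚ-concatMap f g (x ∷ xs) = begin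
  sumℚ (map f (g x ++ concatMap g xs))                   ≡⟨ cong sumℚ (List.map-++ f (g x) (concatMap g xs)) ⟩
  sumℚ (map f (g x) ++ map f (concatMap g xs))           ≡⟨ sumℚ-++ (map f (g x)) _ ⟩
  sumℚ (map f (g x)) + sumℚ (map f (concatMap g xs))     ≡⟨ cong (sumℚ (map f (g x)) +_) (sumℚ-concatMap f g xs) ⟩
  sumℚ (map f (g x)) + sumℚ (map (λ x → sumℚ (map f (g x))) xs) ∎

sumℚ-*ˡ : ∀ {A : Set} c (f : A → ℚ) xs → sumℚ (map (λ x → c * f x) xs) ≡ c * sumℚ (map f xs)
sumℚ-*ˡ c f []       = sym (ℚ.*-zeroʳ c)
sumℚ-*ˡ c f (x ∷ xs) = trans (cong (c * f x +_) (sumℚ-*ˡ c f xs)) (sym (ℚ.*-distribˡ-+ c (f x) _))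

∑< : ℕ → (ℕ → ℚ) → ℚ
∑< N f = sumℚ (applyUpTo f N)

syntax ∑< N (λ i → e) = ∑[ i < N ] e

∑-cong : ∀ {f g : ℕ → ℚ} N → (∀ i → i < N → f i ≡ g i) → ∑[ i < N ] f i ≡ ∑[ i < N ] g i
∑-cong zero    f≡g = refl
∑-cong (suc N) f≡g = cong₂ _+_ (f≡g 0 (s≤s z≤n)) (∑-cong N (λ i i<N → f≡g (suc i) (s≤s i<N)))

∑-0 : ∀ {f : ℕ → ℚ} N → (∀ i → i < N → f i ≡ 0ℚ) → ∑[ i < N ] f i ≡ 0ℚ
∑-0 zero    f≡0 = refl
∑-0 (suc N) f≡0 = trans (cong₂ _+_ (f≡0 0 (s≤s z≤n)) (∑-0 N (λ i i<N → f≡0 (suc i) (s≤s i<N)))) (ℚ.+-identityʳ 0ℚ)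

∑-+ : ∀ (f g : ℕ → ℚ) N → ∑[ i < N ] (f i + g i) ≡ ∑[ i < N ] f i + ∑[ i < N ] g i
∑-+ f g zero    = refl
∑-+ f g (suc N) = trans (cong (f 0 + g 0 +_) (∑-+ (f ∘ suc) (g ∘ suc) N)) (interchange (f 0) (g 0) _ _)
  where
  interchange : ∀ a b c d → a + b + (c + d) ≡ a + c + (b + d)
  interchange = solve-∀ ℚ-ring

∑-*ˡ : ∀ c (f : ℕ → ℚ) N → ∑[ i < N ] (c * f i) ≡ c * (∑[ i < N ] f i)
∑-*ˡ c f zero    = sym (ℚ.*-zeroʳ c)
∑-*ˡ c f (suc N) = trans (cong (c * f 0 +_) (∑-*ˡ c (f ∘ suc) N)) (sym (ℚ.*-distribˡ-+ c (f 0) _))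

∑-∷ʳ : ∀ (f : ℕ → ℚ) N → ∑[ i < suc N ] f i ≡ ∑[ i < N ] f i + f N
∑-∷ʳ f N = begin
  sumℚ (applyUpTo f (suc N))      ≡⟨ cong sumℚ (sym (List.applyUpTo-∷ʳ f N)) ⟩
  sumℚ (applyUpTo f N ++ [ f N ]) ≡⟨ sumℚ-++ (applyUpTo f N) [ f N ] ⟩
  ∑< N f + (f N + 0ℚ)             ≡⟨ cong (∑< N f +_) (ℚ.+-identityʳ (f N)) ⟩
  ∑< N f + f N                    ∎

∑-telescope : ∀ (f : ℕ → ℚ) N → ∑[ i < N ] (f (suc i) - f i) ≡ f N - f 0
∑-telescope f zero    = sym (ℚ.+-inverseʳ (f 0))
∑-telescope f (suc N) = trans (∑-∷ʳ (λ i → f (suc i) - f i) N) (trans (cong (_+ (f (suc N) - f N)) (∑-telescope f N))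
  (collapse (f N) (f (suc N)) (f 0)))
  where
  collapse : ∀ x y z → x - z + (y - x) ≡ y - z
  collapse = solve-∀ ℚ-ring

∑-by-parts : ∀ (t d : ℕ → ℚ) M →
             ∑[ i < M ] ((t i - t (suc i)) * d (suc i)) ≡ ∑[ i < M ] (t i * (d (suc i) - d i)) + t 0 * d 0 - t M * d M
∑-by-parts t d zero    = cancel (t 0 * d 0)
  where
  cancel : ∀ x → 0ℚ ≡ 0ℚ + x - x
  cancel = solve-∀ ℚ-ring
∑-by-parts t d (suc M) = begin
  ∑[ i < suc M ] ((t i - t (suc i)) * d (suc i))                            ≡⟨ ∑-∷ʳ (λ i → (t i - t (suc i)) * d (suc i)) M ⟩
  ∑[ i < M ] ((t i - t (suc i)) * d (suc i)) + (t M - t (suc M)) * d (suc M) ≡⟨ cong (_+ (t M - t (suc M)) * d (suc M)) (∑-by-parts t d M) ⟩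
  S + t 0 * d 0 - t M * d M + (t M - t (suc M)) * d (suc M)                ≡⟨ shift S (t 0 * d 0) (t M) (t (suc M)) (d M) (d (suc M)) ⟩
  S + t M * (d (suc M) - d M) + t 0 * d 0 - t (suc M) * d (suc M)          ≡⟨ cong (λ x → x + t 0 * d 0 - t (suc M) * d (suc M)) (sym (∑-∷ʳ (λ i → t i * (d (suc i) - d i)) M)) ⟩
  ∑[ i < suc M ] (t i * (d (suc i) - d i)) + t 0 * d 0 - t (suc M) * d (suc M) ∎
  where
  S = ∑[ i < M ] (t i * (d (suc i) - d i))
  shift : ∀ S c x y u v → S + c - x * u + (x - y) * v ≡ S + x * (v - u) + c - y * v
  shift = solve-∀ ℚ-ring

Δ² : (ℕ → ℚ) → ℕ → ℚ
Δ² f m = f (suc (suc m)) - (f (suc m) + f (suc m)) + f m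

Δ²-unique : ∀ {f g : ℕ → ℚ} n → f 0 ≡ g 0 → f 1 ≡ g 1 →
            (∀ m → suc (suc m) ≤ n → Δ² f m ≡ Δ² g m) → ∀ N → N ≤ n → f N ≡ g N
Δ²-unique {f} {g} n f0≡g0 f1≡g1 Δ²f≡Δ²g = agree
  where
  unfold : ∀ (h : ℕ → ℚ) m → h (suc (suc m)) ≡ Δ² h m + (h (suc m) + h (suc m)) - h m
  unfold h m = solution (h (suc (suc m))) (h (suc m)) (h m)
    where
    solution : ∀ z y x → z ≡ z - (y + y) + x + (y + y) - x
    solution = solve-∀ ℚ-ring
  agree₂ : ∀ N → suc N ≤ n → f N ≡ g N × f (suc N) ≡ g (suc N)
  agree₂ zero    _      = f0≡g0 , f1≡g1
  agree₂ (suc N) 2+N≤n with agree₂ N (ℕ.<⇒≤ 2+N≤n)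
  ... | fN≡gN , f1+N≡g1+N = f1+N≡g1+N , (begin
    f (suc (suc N))                                  ≡⟨ unfold f N ⟩
    Δ² f N + (f (suc N) + f (suc N)) - f N           ≡⟨ cong₂ (λ x y → x + (y + y) - _) (Δ²f≡Δ²g N 2+N≤n) f1+N≡g1+N ⟩
    Δ² g N + (g (suc N) + g (suc N)) - f N           ≡⟨ cong (Δ² g N + (g (suc N) + g (suc N)) -_) fN≡gN ⟩
    Δ² g N + (g (suc N) + g (suc N)) - g N           ≡⟨ sym (unfold g N) ⟩
    g (suc (suc N))                                  ∎)
  agree : ∀ N → N ≤ n → f N ≡ g N
  agree zero    _   = f0≡g0
  agree (suc N) N<n = proj₂ (agree₂ N N<n)

Δ²-*ʳ : ∀ (f : ℕ → ℚ) c m → Δ² (λ m → f m * c) m ≡ Δ² f m * c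
Δ²-*ʳ f c m = distrib (f (suc (suc m))) (f (suc m)) (f m) c
  where
  distrib : ∀ x y z c → x * c - (y * c + y * c) + z * c ≡ (x - (y + y) + z) * c
  distrib = solve-∀ ℚ-ring

∑-Δ² : ∀ (f : ℕ → ℕ → ℚ) n m → Δ² (λ m → ∑[ i < n ] f m i) m ≡ ∑[ i < n ] Δ² (λ m → f m i) m
∑-Δ² f zero    m = refl
∑-Δ² f (suc n) m = trans (split (f (suc (suc m)) 0) (f (suc m) 0) (f m 0) (S (suc (suc m))) (S (suc m)) (S m))
  (cong (Δ² (λ m → f m 0) m +_) (∑-Δ² (λ m i → f m (suc i)) n m))
  where
  S = λ m → ∑[ i < n ] f m (suc i)
  split : ∀ x y z X Y Z → (x + X) - ((y + Y) + (y + Y)) + (z + Z) ≡ (x - (y + y) + z) + (X - (Y + Y) + Z)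
  split = solve-∀ ℚ-ring

convolution : (ℕ → ℚ) → ℕ → ℚ
convolution h N = ∑[ i < N ] (ι (suc i) * h (N ∸ suc i))

convolution-suc : ∀ h N → convolution h (suc N) ≡ h N + convolution h N + ∑[ i < N ] h (N ∸ suc i)
convolution-suc h N = begin
  ι 1 * h N + ∑[ i < N ] (ι (suc (suc i)) * h (N ∸ suc i))
    ≡⟨ cong₂ _+_ (ℚ.*-identityˡ (h N)) (∑-cong N (λ i _ → split (ι (suc i)) (h (N ∸ suc i)) (ι-suc (suc i)))) ⟩
  h N + ∑[ i < N ] (ι (suc i) * h (N ∸ suc i) + h (N ∸ suc i))
    ≡⟨ cong (h N +_) (∑-+ (λ i → ι (suc i) * h (N ∸ suc i)) (λ i → h (N ∸ suc i)) N) ⟩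
  h N + (convolution h N + ∑[ i < N ] h (N ∸ suc i))
    ≡⟨ sym (ℚ.+-assoc (h N) _ _) ⟩
  h N + convolution h N + ∑[ i < N ] h (N ∸ suc i) ∎
  where
  split : ∀ {a′} a x → a′ ≡ a + 1ℚ → a′ * x ≡ a * x + x
  split a x refl = distrib a x
    where
    distrib : ∀ a x → (a + 1ℚ) * x ≡ a * x + x
    distrib = solve-∀ ℚ-ring

convolution-Δ² : ∀ h m → Δ² (convolution h) m ≡ h (suc m)
convolution-Δ² h m = begin
  C (suc (suc m)) - (C (suc m) + C (suc m)) + C m
    ≡⟨ cong (λ x → x - (C (suc m) + C (suc m)) + C m) (convolution-suc h (suc m)) ⟩
  h (suc m) + C (suc m) + (h m + T) - (C (suc m) + C (suc m)) + C m
    ≡⟨ cong (λ y → h (suc m) + y + (h m + T) - (y + y) + C m) (convolution-suc h m) ⟩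
  h (suc m) + (h m + C m + T) + (h m + T) - ((h m + C m + T) + (h m + C m + T)) + C m
    ≡⟨ cancel (h (suc m)) (h m) (C m) T ⟩
  h (suc m) ∎
  where
  C = convolution h
  T = ∑[ i < m ] h (m ∸ suc i)
  cancel : ∀ h₁ h₀ c t → h₁ + (h₀ + c + t) + (h₀ + t) - ((h₀ + c + t) + (h₀ + c + t)) + c ≡ h₁
  cancel = solve-∀ ℚ-ring

convolution-unique : ∀ (h G : ℕ → ℚ) n → G 0 ≡ 0ℚ → G 1 ≡ h 0 →
                     (∀ m → suc (suc m) ≤ n → Δ² G m ≡ h (suc m)) →
                     ∀ N → N ≤ n → convolution h N ≡ G N
convolution-unique h G n G0≡0 G1≡h0 Δ²G≡h =
  Δ²-unique n (sym G0≡0) (trans (ℚ.+-identityʳ (ι 1 * h 0)) (trans (ℚ.*-identityˡ (h 0)) (sym G1≡h0)))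
    (λ m 2+m≤n → trans (convolution-Δ² h m) (sym (Δ²G≡h m 2+m≤n)))

δ : ℕ → ℚ
δ zero    = 1ℚ
δ (suc _) = 0ℚ

convolution-δ : ∀ N → convolution δ N ≡ ι N
convolution-δ N = convolution-unique δ ι N refl refl Δ²ι≡0 N ℕ.≤-refl
  where
  Δ²ι≡0 : ∀ m → suc (suc m) ≤ N → Δ² ι m ≡ 0ℚ
  Δ²ι≡0 m _ = trans (cong₂ (λ x y → x - (y + y) + ι m) (trans (ι-suc (suc m)) (cong (_+ 1ℚ) (ι-suc m))) (ι-suc m))
    (linear (ι m))
    where
    linear : ∀ x → x + 1ℚ + 1ℚ - ((x + 1ℚ) + (x + 1ℚ)) + x ≡ 0ℚ
    linear = solve-∀ ℚ-ring

-- Falling factorials and the closed form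

falling : ℚ → ℕ → ℚ
falling x zero    = 1ℚ
falling x (suc k) = x * falling (x - 1ℚ) k

falling-last : ∀ x k → falling x (suc k) ≡ falling x k * (x - ι k)
falling-last x zero    = comm x
  where
  comm : ∀ x → x * 1ℚ ≡ 1ℚ * (x - 0ℚ)
  comm = solve-∀ ℚ-ring
falling-last x (suc k) = begin
  x * falling (x - 1ℚ) (suc k)               ≡⟨ cong (x *_) (falling-last (x - 1ℚ) k) ⟩
  x * (falling (x - 1ℚ) k * (x - 1ℚ - ι k))  ≡⟨ regroup x (falling (x - 1ℚ) k) (ι k) ⟩
  x * falling (x - 1ℚ) k * (x - (1ℚ + ι k))  ≡⟨ cong (λ y → x * falling (x - 1ℚ) k * (x - y)) (sym (ι-+ 1 k)) ⟩
  x * falling (x - 1ℚ) k * (x - ι (suc k))   ∎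
  where
  regroup : ∀ x p y → x * (p * (x - 1ℚ - y)) ≡ x * p * (x - (1ℚ + y))
  regroup = solve-∀ ℚ-ring

falling-ι-suc : ∀ m k → falling (ι (suc m)) (suc k) ≡ ι (suc m) * falling (ι m) k
falling-ι-suc m k = cong (λ x → ι (suc m) * falling x k) ι-pred
  where
  ι-pred : ι (suc m) - 1ℚ ≡ ι m
  ι-pred = trans (cong (_- 1ℚ) (ι-suc m)) (cancel (ι m))
    where
    cancel : ∀ x → x + 1ℚ - 1ℚ ≡ x
    cancel = solve-∀ ℚ-ring

falling-ι-vanish : ∀ {m k} → m ≤ k → falling (ι m) (suc k) ≡ 0ℚ
falling-ι-vanish {zero}  {k}     _         = ℚ.*-zeroˡ (falling (ι 0 - 1ℚ) k)
falling-ι-vanish {suc m} {suc k} (s≤s m≤k) = begin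
  falling (ι (suc m)) (suc (suc k)) ≡⟨ falling-ι-suc m (suc k) ⟩
  ι (suc m) * falling (ι m) (suc k) ≡⟨ cong (ι (suc m) *_) (falling-ι-vanish m≤k) ⟩
  ι (suc m) * 0ℚ                    ≡⟨ ℚ.*-zeroʳ (ι (suc m)) ⟩
  0ℚ                                ∎

falling-ι-Δ : ∀ m k → falling (ι (suc m)) (suc k) ≡ falling (ι m) (suc k) + ι (suc k) * falling (ι m) k
falling-ι-Δ m k = begin
  falling (ι (suc m)) (suc k)           ≡⟨ falling-ι-suc m k ⟩
  ι (suc m) * P                         ≡⟨ cong (_* P) (ι-suc m) ⟩
  (ι m + 1ℚ) * P                        ≡⟨ split (ι m) (ι k) P ⟩
  P * (ι m - ι k) + (ι k + 1ℚ) * P      ≡⟨ sym (cong₂ _+_ (falling-last (ι m) k) (cong (_* P) (ι-suc k))) ⟩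
  falling (ι m) (suc k) + ι (suc k) * P ∎
  where
  P = falling (ι m) k
  split : ∀ x y p → (x + 1ℚ) * p ≡ p * (x - y) + (y + 1ℚ) * p
  split = solve-∀ ℚ-ring

falling-ι-Δ² : ∀ m k → Δ² (λ m → falling (ι m) (suc (suc k))) m ≡ ι (suc k) * ι (suc (suc k)) * falling (ι m) k
falling-ι-Δ² m k = begin
  f (suc (suc m)) - (f (suc m) + f (suc m)) + f m
    ≡⟨ cong (λ x → x - (f (suc m) + f (suc m)) + f m) (falling-ι-Δ (suc m) (suc k)) ⟩
  f (suc m) + c₂ * falling (ι (suc m)) (suc k) - (f (suc m) + f (suc m)) + f m
    ≡⟨ cong₂ (λ y z → y + c₂ * z - (y + y) + f m) (falling-ι-Δ m (suc k)) (falling-ι-Δ m k) ⟩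
  f m + c₂ * B + c₂ * (B + c₁ * P) - ((f m + c₂ * B) + (f m + c₂ * B)) + f m
    ≡⟨ collapse (f m) B P c₁ c₂ ⟩
  c₁ * c₂ * P ∎
  where
  f = λ m → falling (ι m) (suc (suc k))
  B = falling (ι m) (suc k)
  P = falling (ι m) k
  c₁ = ι (suc k)
  c₂ = ι (suc (suc k))
  collapse : ∀ a b p c₁ c₂ → a + c₂ * b + c₂ * (b + c₁ * p) - ((a + c₂ * b) + (a + c₂ * b)) + a ≡ c₁ * c₂ * p
  collapse = solve-∀ ℚ-ring

invFalling : ℕ → ℕ → ℚ
invFalling n zero    = 1ℚ
invFalling n (suc i) = invFalling n i * inv (n ∸ suc i)

invFalling-cancel : ∀ {n i} → suc i < n → invFalling n (suc i) * ι (n ∸ suc i) ≡ invFalling n i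
invFalling-cancel {n} {i} 1+i<n = begin
  invFalling n i * inv (n ∸ suc i) * ι (n ∸ suc i) ≡⟨ ℚ.*-assoc (invFalling n i) _ _ ⟩
  invFalling n i * (inv (n ∸ suc i) * ι (n ∸ suc i)) ≡⟨ cong (invFalling n i *_) (trans (ℚ.*-comm (inv (n ∸ suc i)) (ι (n ∸ suc i))) (ι*inv≡1 (n ∸ suc i) (ℕ.m<n⇒0<n∸m 1+i<n))) ⟩
  invFalling n i * 1ℚ                                ≡⟨ ℚ.*-identityʳ (invFalling n i) ⟩
  invFalling n i                                     ∎

fallRatio : ℕ → ℕ → ℕ → ℚ
fallRatio n m i = falling (ι m) (suc i) * invFalling n i

fallRatio-diag : ∀ {n i} → i < n → fallRatio n n i ≡ ι n
fallRatio-diag {n} {zero}  _     = unit (ι n)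
  where
  unit : ∀ x → x * 1ℚ * 1ℚ ≡ x
  unit = solve-∀ ℚ-ring
fallRatio-diag {n} {suc k} 1+k<n = begin
  falling (ι n) (suc (suc k)) * invFalling n (suc k)
    ≡⟨ cong (_* invFalling n (suc k)) (falling-last (ι n) (suc k)) ⟩
  falling (ι n) (suc k) * (ι n - ι (suc k)) * invFalling n (suc k)
    ≡⟨ cong (λ x → falling (ι n) (suc k) * x * invFalling n (suc k)) (sym (ι-∸ (ℕ.<⇒≤ 1+k<n))) ⟩
  falling (ι n) (suc k) * ι (n ∸ suc k) * invFalling n (suc k)
    ≡⟨ swap (falling (ι n) (suc k)) (ι (n ∸ suc k)) (invFalling n (suc k)) ⟩
  falling (ι n) (suc k) * (invFalling n (suc k) * ι (n ∸ suc k))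
    ≡⟨ cong (falling (ι n) (suc k) *_) (invFalling-cancel 1+k<n) ⟩
  fallRatio n n k
    ≡⟨ fallRatio-diag (ℕ.<⇒≤ 1+k<n) ⟩
  ι n ∎
  where
  swap : ∀ x y z → x * y * z ≡ x * (z * y)
  swap = solve-∀ ℚ-ring

fallRatio-vanish : ∀ n {m} i → m ≤ i → fallRatio n m i ≡ 0ℚ
fallRatio-vanish n i m≤i = trans (cong (_* invFalling n i) (falling-ι-vanish m≤i)) (ℚ.*-zeroˡ (invFalling n i))

fallRatio-Δ² : ∀ {n m k} → suc (suc m) ≤ n → suc k < n →
               ι (n ∸ suc m) * ι (suc m) * Δ² (λ m → fallRatio n m (suc k)) m
                 ≡ ι (suc k) * ι (suc (suc k)) * (fallRatio n (suc m) k - fallRatio n (suc m) (suc k))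
fallRatio-Δ² {n} {m} {k} 2+m≤n 1+k<n = begin
  ι (n ∸ suc m) * a * Δ² (λ m → falling (ι m) (suc (suc k)) * c) m
    ≡⟨ cong₂ (λ u v → u * a * v) (ι-∸ (ℕ.<⇒≤ 2+m≤n)) (Δ²-*ʳ (λ m → falling (ι m) (suc (suc k))) c m) ⟩
  (ι n - a) * a * (Δ² (λ m → falling (ι m) (suc (suc k))) m * c)
    ≡⟨ cong (λ v → (ι n - a) * a * (v * c)) (falling-ι-Δ² m k) ⟩
  (ι n - a) * a * (b * b′ * P * c)
    ≡⟨ regroup a b b′ (ι n) P c ⟩
  b * b′ * (a * P * (c * (ι n - b)) - a * P * (a - b) * c)
    ≡⟨ cong (b * b′ *_) (sym (cong₂ _-_ fallRatio-k fallRatio-1+k)) ⟩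
  b * b′ * (fallRatio n (suc m) k - fallRatio n (suc m) (suc k)) ∎
  where
  a = ι (suc m)
  b = ι (suc k)
  b′ = ι (suc (suc k))
  P = falling (ι m) k
  c = invFalling n (suc k)
  regroup : ∀ a b b′ N p c → (N - a) * a * (b * b′ * p * c) ≡ b * b′ * (a * p * (c * (N - b)) - a * p * (a - b) * c)
  regroup = solve-∀ ℚ-ring
  fallRatio-k : fallRatio n (suc m) k ≡ a * P * (c * (ι n - b))
  fallRatio-k = cong₂ _*_ (falling-ι-suc m k)
    (trans (sym (invFalling-cancel 1+k<n)) (cong (c *_) (ι-∸ (ℕ.<⇒≤ 1+k<n))))
  fallRatio-1+k : fallRatio n (suc m) (suc k) ≡ a * P * (a - b) * c
  fallRatio-1+k = cong (_* c) (trans (falling-last a (suc k)) (cong (_* (a - b)) (falling-ι-suc m k)))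

esym-∷ʳ : ∀ j xs y → esym (suc j) (xs ∷ʳ y) ≡ esym (suc j) xs + y * esym j xs
esym-∷ʳ j       []       y = ℚ.+-comm (y * esym j []) 0ℚ
esym-∷ʳ zero    (x ∷ xs) y = trans (cong (x * 1ℚ +_) (esym-∷ʳ zero xs y)) (sym (ℚ.+-assoc (x * 1ℚ) (esym 1 xs) (y * 1ℚ)))
esym-∷ʳ (suc j) (x ∷ xs) y = trans (cong₂ (λ u v → x * u + v) (esym-∷ʳ j xs y) (esym-∷ʳ (suc j) xs y))
  (regroup x y (esym (suc j) xs) (esym j xs) (esym (suc (suc j)) xs))
  where
  regroup : ∀ x y a b c → x * (a + y * b) + (c + y * a) ≡ x * a + c + y * (x * b + a)
  regroup = solve-∀ ℚ-ring

recipEntry : ℕ → ℚ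
recipEntry i = frac 1 (suc i ℕ.* suc (suc i))

σ : ℕ → ℕ → ℚ
σ j zero    = 0ℚ
σ j (suc i) = esym j (applyUpTo recipEntry i)

-- β i j collects the terms of e_j(recipEntry 0, recipEntry 1, …) whose largest index is i − 1.
β : ℕ → ℕ → ℚ
β i j = σ j (suc i) - σ j i

∑-β : ∀ j N → ∑[ i < N ] β i j ≡ σ j N
∑-β j N = trans (∑-telescope (σ j) N) (ℚ.+-identityʳ (σ j N))

β-scaled : ∀ i j → ι i * ι (suc i) * β i (suc j) ≡ σ j i
β-scaled zero    j = refl
β-scaled (suc k) j = begin
  ι (suc k) * ι (suc (suc k)) * (esym (suc j) (applyUpTo recipEntry (suc k)) - esym (suc j) L)
    ≡⟨ cong (λ xs → ι (suc k) * ι (suc (suc k)) * (esym (suc j) xs - esym (suc j) L)) (sym (List.applyUpTo-∷ʳ recipEntry k)) ⟩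
  ι (suc k) * ι (suc (suc k)) * (esym (suc j) (L ∷ʳ recipEntry k) - esym (suc j) L)
    ≡⟨ cong (λ x → ι (suc k) * ι (suc (suc k)) * (x - esym (suc j) L)) (esym-∷ʳ j L (recipEntry k)) ⟩
  ι (suc k) * ι (suc (suc k)) * (esym (suc j) L + recipEntry k * esym j L - esym (suc j) L)
    ≡⟨ regroup (ι (suc k)) (ι (suc (suc k))) (recipEntry k) (esym j L) (esym (suc j) L) ⟩
  ι (suc k) * ι (suc (suc k)) * recipEntry k * esym j L
    ≡⟨ cong (λ x → x * recipEntry k * esym j L) (sym (ι-* (suc k) (suc (suc k)))) ⟩
  ι (suc k ℕ.* suc (suc k)) * inv (suc k ℕ.* suc (suc k)) * esym j L
    ≡⟨ cong (_* esym j L) (ι*inv≡1 (suc k ℕ.* suc (suc k)) (s≤s z≤n)) ⟩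
  1ℚ * esym j L
    ≡⟨ ℚ.*-identityˡ (esym j L) ⟩
  esym j L ∎
  where
  L = applyUpTo recipEntry k
  regroup : ∀ a b r e E → a * b * (E + r * e - E) ≡ a * b * r * e
  regroup = solve-∀ ℚ-ring

F : ℕ → ℕ → ℕ → ℚ
F n j m = ∑[ i < n ] (fallRatio n m i * β i j)

H : ℕ → ℕ → ℕ → ℚ
H n j r = inv (n ∸ r) * inv r * F n j r

F-at-zero : ∀ n j → F n j 0 ≡ 0ℚ
F-at-zero n j = ∑-0 n (λ i _ → trans (cong (_* β i j) (fallRatio-vanish n i z≤n)) (ℚ.*-zeroˡ (β i j)))

F-suc-at-one : ∀ n j → F n (suc j) 1 ≡ 0ℚ
F-suc-at-one n j = ∑-0 n vanish
  where
  vanish : ∀ i → i < n → fallRatio n 1 i * β i (suc j) ≡ 0ℚ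
  vanish zero    _ = ℚ.*-zeroʳ (fallRatio n 1 0)
  vanish (suc k) _ = trans (cong (_* β (suc k) (suc j)) (fallRatio-vanish n (suc k) (s≤s z≤n))) (ℚ.*-zeroˡ (β (suc k) (suc j)))

F-degree-zero : ∀ {n} N → N ≤ n → F n 0 N ≡ ι N
F-degree-zero {zero}   zero _ = refl
F-degree-zero {suc n′} N    _ = begin
  ι N * 1ℚ * 1ℚ * 1ℚ + ∑[ k < n′ ] (fallRatio (suc n′) N (suc k) * 0ℚ)
    ≡⟨ cong (ι N * 1ℚ * 1ℚ * 1ℚ +_) (∑-0 n′ (λ k _ → ℚ.*-zeroʳ (fallRatio (suc n′) N (suc k)))) ⟩
  ι N * 1ℚ * 1ℚ * 1ℚ + 0ℚ
    ≡⟨ unit (ι N) ⟩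
  ι N ∎
  where
  unit : ∀ x → x * 1ℚ * 1ℚ * 1ℚ + 0ℚ ≡ x
  unit = solve-∀ ℚ-ring

F-at-n : ∀ n j → F n j n ≡ ι n * σ j n
F-at-n n j = begin
  ∑[ i < n ] (fallRatio n n i * β i j) ≡⟨ ∑-cong n (λ i i<n → cong (_* β i j) (fallRatio-diag i<n)) ⟩
  ∑[ i < n ] (ι n * β i j)             ≡⟨ ∑-*ˡ (ι n) (λ i → β i j) n ⟩
  ι n * ∑[ i < n ] β i j               ≡⟨ cong (ι n *_) (∑-β j n) ⟩
  ι n * σ j n                          ∎

fallRatio-β-Δ² : ∀ {n m k} j → suc (suc m) ≤ n → suc k < n →
                 ι (n ∸ suc m) * ι (suc m) * Δ² (λ m → fallRatio n m (suc k) * β (suc k) (suc j)) m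
                   ≡ (fallRatio n (suc m) k - fallRatio n (suc m) (suc k)) * σ j (suc k)
fallRatio-β-Δ² {n} {m} {k} j 2+m≤n 1+k<n = begin
  c * Δ² (λ m → fallRatio n m (suc k) * β′) m      ≡⟨ cong (c *_) (Δ²-*ʳ (λ m → fallRatio n m (suc k)) β′ m) ⟩
  c * (Δ² (λ m → fallRatio n m (suc k)) m * β′)    ≡⟨ sym (ℚ.*-assoc c _ β′) ⟩
  c * Δ² (λ m → fallRatio n m (suc k)) m * β′      ≡⟨ cong (_* β′) (fallRatio-Δ² 2+m≤n 1+k<n) ⟩
  b * b′ * d * β′                                  ≡⟨ regroup b b′ d β′ ⟩
  d * (b * b′ * β′)                                ≡⟨ cong (d *_) (β-scaled (suc k) j) ⟩
  d * σ j (suc k)                                  ∎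
  where
  c = ι (n ∸ suc m) * ι (suc m)
  d = fallRatio n (suc m) k - fallRatio n (suc m) (suc k)
  β′ = β (suc k) (suc j)
  b = ι (suc k)
  b′ = ι (suc (suc k))
  regroup : ∀ b b′ d x → b * b′ * d * x ≡ d * (b * b′ * x)
  regroup = solve-∀ ℚ-ring

F-Δ²-scaled : ∀ {n m} j → suc (suc m) ≤ n → ι (n ∸ suc m) * ι (suc m) * Δ² (F n (suc j)) m ≡ F n j (suc m)
F-Δ²-scaled {suc n′} {m} j 2+m≤n = begin
  c * Δ² (F n (suc j)) m
    ≡⟨ cong (c *_) (∑-Δ² (λ m i → fallRatio n m i * β i (suc j)) n m) ⟩
  c * ∑[ i < n ] Δ² (λ m → fallRatio n m i * β i (suc j)) m
    ≡⟨ sym (∑-*ˡ c (λ i → Δ² (λ m → fallRatio n m i * β i (suc j)) m) n) ⟩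
  ∑[ i < n ] (c * Δ² (λ m → fallRatio n m i * β i (suc j)) m)
    ≡⟨ cong₂ _+_ first-term (∑-cong n′ (λ k k<n′ → fallRatio-β-Δ² j 2+m≤n (s≤s k<n′))) ⟩
  0ℚ + ∑[ k < n′ ] ((t k - t (suc k)) * σ j (suc k))
    ≡⟨ trans (ℚ.+-identityˡ _) (∑-by-parts t (σ j) n′) ⟩
  S + t 0 * 0ℚ - t n′ * σ j n′
    ≡⟨ cong (λ x → S + t 0 * 0ℚ - x * σ j n′) t-last ⟩
  S + t 0 * 0ℚ - 0ℚ * σ j n′
    ≡⟨ drop-zeros S (t 0) (σ j n′) (β n′ j) ⟩
  S + 0ℚ * β n′ j
    ≡⟨ cong (λ x → S + x * β n′ j) (sym t-last) ⟩
  S + t n′ * β n′ j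
    ≡⟨ sym (∑-∷ʳ (λ k → t k * β k j) n′) ⟩
  F n j (suc m) ∎
  where
  n = suc n′
  c = ι (n ∸ suc m) * ι (suc m)
  t = fallRatio n (suc m)
  S = ∑[ k < n′ ] (t k * β k j)
  t-last : t n′ ≡ 0ℚ
  t-last = fallRatio-vanish n n′ (ℕ.≤-pred 2+m≤n)
  first-term : c * Δ² (λ m → fallRatio n m 0 * β 0 (suc j)) m ≡ 0ℚ
  first-term = trans (cong (c *_) (Δ²-*ʳ (λ m → fallRatio n m 0) 0ℚ m)) (annihilate c (Δ² (λ m → fallRatio n m 0) m))
    where
    annihilate : ∀ c x → c * (x * 0ℚ) ≡ 0ℚ
    annihilate = solve-∀ ℚ-ring
  drop-zeros : ∀ S x y z → S + x * 0ℚ - 0ℚ * y ≡ S + 0ℚ * z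
  drop-zeros = solve-∀ ℚ-ring

F-Δ² : ∀ {n m} j → suc (suc m) ≤ n → Δ² (F n (suc j)) m ≡ H n j (suc m)
F-Δ² {n} {m} j 2+m≤n = cancel-ι*ι (n ∸ suc m) (suc m) (ℕ.m<n⇒0<n∸m 2+m≤n) (s≤s z≤n) (F-Δ²-scaled j 2+m≤n)

H-at-zero : ∀ n j → H n j 0 ≡ 0ℚ
H-at-zero n j = trans (cong (inv (n ∸ 0) * inv 0 *_) (F-at-zero n j)) (ℚ.*-zeroʳ (inv (n ∸ 0) * inv 0))

convolution-H : ∀ n j N → N ≤ n → convolution (H n j) N ≡ F n (suc j) N
convolution-H n j = convolution-unique (H n j) (F n (suc j)) n (F-at-zero n (suc j))
  (trans (F-suc-at-one n j) (sym (H-at-zero n j))) (λ m → F-Δ² j)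

-- Compositions

partialSumsFrom : ℕ → List ℕ → List ℕ
partialSumsFrom a []       = []
partialSumsFrom a (x ∷ xs) = a ℕ.+ x ∷ partialSumsFrom (a ℕ.+ x) xs

map-+-partialSums : ∀ a xs → map (a ℕ.+_) (partialSums xs) ≡ partialSumsFrom a xs
map-+-partialSums a []       = refl
map-+-partialSums a (x ∷ xs) = cong (a ℕ.+ x ∷_) (begin
  map (a ℕ.+_) (map (x ℕ.+_) (partialSums xs)) ≡⟨ sym (List.map-∘ (partialSums xs)) ⟩
  map (λ y → a ℕ.+ (x ℕ.+ y)) (partialSums xs)  ≡⟨ List.map-cong (λ y → sym (ℕ.+-assoc a x y)) (partialSums xs) ⟩
  map ((a ℕ.+ x) ℕ.+_) (partialSums xs)         ≡⟨ map-+-partialSums (a ℕ.+ x) xs ⟩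
  partialSumsFrom (a ℕ.+ x) xs                  ∎)

partialSums≡partialSumsFrom-0 : ∀ xs → partialSums xs ≡ partialSumsFrom 0 xs
partialSums≡partialSumsFrom-0 xs = trans (sym (List.map-id (partialSums xs))) (map-+-partialSums 0 xs)

init-partialSumsFrom-∷ʳ : ∀ a xs z → init (partialSumsFrom a (xs ∷ʳ z)) ≡ partialSumsFrom a xs
init-partialSumsFrom-∷ʳ a []           z = refl
init-partialSumsFrom-∷ʳ a (x ∷ [])     z = refl
init-partialSumsFrom-∷ʳ a (x ∷ y ∷ xs) z = cong (a ℕ.+ x ∷_) (init-partialSumsFrom-∷ʳ (a ℕ.+ x) (y ∷ xs) z)

product-partialSumsFrom-∷ʳ : ∀ a xs z → product (partialSumsFrom a (xs ∷ʳ z)) ≡ product (partialSumsFrom a xs) ℕ.* (a ℕ.+ sum (xs ∷ʳ z))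
product-partialSumsFrom-∷ʳ a []       z = shape a z
  where
  shape : ∀ a z → (a ℕ.+ z) ℕ.* 1 ≡ 1 ℕ.* (a ℕ.+ (z ℕ.+ 0))
  shape = ℕ-Solver.solve-∀
product-partialSumsFrom-∷ʳ a (x ∷ xs) z = begin
  (a ℕ.+ x) ℕ.* product (partialSumsFrom (a ℕ.+ x) (xs ∷ʳ z))
    ≡⟨ cong ((a ℕ.+ x) ℕ.*_) (product-partialSumsFrom-∷ʳ (a ℕ.+ x) xs z) ⟩
  (a ℕ.+ x) ℕ.* (product (partialSumsFrom (a ℕ.+ x) xs) ℕ.* (a ℕ.+ x ℕ.+ sum (xs ∷ʳ z)))
    ≡⟨ regroup (a ℕ.+ x) (product (partialSumsFrom (a ℕ.+ x) xs)) a x (sum (xs ∷ʳ z)) ⟩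
  (a ℕ.+ x) ℕ.* product (partialSumsFrom (a ℕ.+ x) xs) ℕ.* (a ℕ.+ (x ℕ.+ sum (xs ∷ʳ z))) ∎
  where
  regroup : ∀ u p a x s → u ℕ.* (p ℕ.* (a ℕ.+ x ℕ.+ s)) ≡ u ℕ.* p ℕ.* (a ℕ.+ (x ℕ.+ s))
  regroup = ℕ-Solver.solve-∀

leftProduct : ℕ → List ℕ → ℕ
leftProduct a q = product (init (partialSumsFrom a q))

rightProduct : List ℕ → ℕ
rightProduct q = product (init (partialSumsFrom 0 (reverse q)))

rightProduct-∷ : ∀ p y ys → rightProduct (p ∷ y ∷ ys) ≡ rightProduct (y ∷ ys) ℕ.* sum (y ∷ ys)
rightProduct-∷ p y ys = begin
  product (init (partialSumsFrom 0 (reverse (p ∷ y ∷ ys))))  ≡⟨ cong (product ∘ init ∘ partialSumsFrom 0) (List.unfold-reverse p (y ∷ ys)) ⟩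
  product (init (partialSumsFrom 0 (reverse (y ∷ ys) ∷ʳ p)))  ≡⟨ cong product (init-partialSumsFrom-∷ʳ 0 (reverse (y ∷ ys)) p) ⟩
  product (partialSumsFrom 0 (reverse (y ∷ ys)))              ≡⟨ cong (product ∘ partialSumsFrom 0) (List.unfold-reverse y ys) ⟩
  product (partialSumsFrom 0 (reverse ys ∷ʳ y))               ≡⟨ product-partialSumsFrom-∷ʳ 0 (reverse ys) y ⟩
  product (partialSumsFrom 0 (reverse ys)) ℕ.* sum (reverse ys ∷ʳ y)
    ≡⟨ cong₂ ℕ._*_ (sym (cong product (init-partialSumsFrom-∷ʳ 0 (reverse ys) y))) (sym (cong sum (List.unfold-reverse y ys))) ⟩
  product (init (partialSumsFrom 0 (reverse ys ∷ʳ y))) ℕ.* sum (reverse (y ∷ ys))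
    ≡⟨ cong₂ (λ xs s → product (init (partialSumsFrom 0 xs)) ℕ.* s) (sym (List.unfold-reverse y ys)) (sum-↭ (↭-reverse (y ∷ ys))) ⟩
  rightProduct (y ∷ ys) ℕ.* sum (y ∷ ys) ∎

-- With n = a + sum q, the denominator is ∏ (a + s_i) · ∏ (n − a − s_i) over the proper partial sums s_i of q.
weight : ℕ → List ℕ → ℚ
weight a q = frac (product q) (leftProduct a q ℕ.* rightProduct q)

weight-∷ : ∀ a p y ys → weight a (p ∷ y ∷ ys) ≡ ι p * inv (a ℕ.+ p) * inv (sum (y ∷ ys)) * weight (a ℕ.+ p) (y ∷ ys)
weight-∷ a p y ys = begin
  frac (p ℕ.* P) (a′ ℕ.* A ℕ.* rightProduct (p ∷ y ∷ ys))
    ≡⟨ cong (λ r → frac (p ℕ.* P) (a′ ℕ.* A ℕ.* r)) (rightProduct-∷ p y ys) ⟩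
  frac (p ℕ.* P) (a′ ℕ.* A ℕ.* (R ℕ.* s))
    ≡⟨ frac≡ι*inv (p ℕ.* P) (a′ ℕ.* A ℕ.* (R ℕ.* s)) ⟩
  ι (p ℕ.* P) * inv (a′ ℕ.* A ℕ.* (R ℕ.* s))
    ≡⟨ cong₂ _*_ (ι-* p P) (trans (inv-* (a′ ℕ.* A) (R ℕ.* s)) (cong₂ _*_ (inv-* a′ A) (inv-* R s))) ⟩
  ι p * ι P * (inv a′ * inv A * (inv R * inv s))
    ≡⟨ regroup (ι p) (ι P) (inv a′) (inv A) (inv R) (inv s) ⟩
  ι p * inv a′ * inv s * (ι P * (inv A * inv R))
    ≡⟨ cong (ι p * inv a′ * inv s *_) (sym (trans (frac≡ι*inv P (A ℕ.* R)) (cong (ι P *_) (inv-* A R)))) ⟩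
  ι p * inv a′ * inv s * weight a′ (y ∷ ys) ∎
  where
  a′ = a ℕ.+ p
  P = product (y ∷ ys)
  A = leftProduct a′ (y ∷ ys)
  R = rightProduct (y ∷ ys)
  s = sum (y ∷ ys)
  regroup : ∀ p P a A R s → p * P * (a * A * (R * s)) ≡ p * a * s * (P * (A * R))
  regroup = solve-∀ ℚ-ring

summand≡weight : ∀ n p → summand n p ≡ inv n * inv n * weight 0 p
summand≡weight n p = begin
  frac (product p) (product (init (partialSums p)) ℕ.* n ℕ.* (product (init (partialSums (reverse p))) ℕ.* n))
    ≡⟨ cong₂ (λ u v → frac (product p) (product (init u) ℕ.* n ℕ.* (product (init v) ℕ.* n)))
         (partialSums≡partialSumsFrom-0 p) (partialSums≡partialSumsFrom-0 (reverse p)) ⟩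
  frac (product p) (A ℕ.* n ℕ.* (R ℕ.* n))
    ≡⟨ frac≡ι*inv (product p) (A ℕ.* n ℕ.* (R ℕ.* n)) ⟩
  ι (product p) * inv (A ℕ.* n ℕ.* (R ℕ.* n))
    ≡⟨ cong (ι (product p) *_) (trans (inv-* (A ℕ.* n) (R ℕ.* n)) (cong₂ _*_ (inv-* A n) (inv-* R n))) ⟩
  ι (product p) * (inv A * inv n * (inv R * inv n))
    ≡⟨ regroup (ι (product p)) (inv A) (inv R) (inv n) ⟩
  inv n * inv n * (ι (product p) * (inv A * inv R))
    ≡⟨ cong (inv n * inv n *_) (sym (trans (frac≡ι*inv (product p) (A ℕ.* R)) (cong (ι (product p) *_) (inv-* A R)))) ⟩
  inv n * inv n * weight 0 p ∎
  where
  A = leftProduct 0 p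
  R = rightProduct p
  regroup : ∀ x a r c → x * (a * c * (r * c)) ≡ c * c * (x * (a * r))
  regroup = solve-∀ ℚ-ring

compositions-shape : ∀ l M → All (λ q → length q ≡ l × sum q ≡ M) (compositions l M)
compositions-shape zero    zero    = (refl , refl) ∷ []
compositions-shape zero    (suc M) = []
compositions-shape (suc l) M       = All.concat⁺ (All.map⁺ (All.applyUpTo⁺₁ suc M λ {i} i<M →
  All.map⁺ (All.map (λ (len≡l , sum≡M∸1+i) → cong suc len≡l , trans (cong (suc i ℕ.+_) sum≡M∸1+i) (ℕ.m+[n∸m]≡n i<M))
                    (compositions-shape l (M ∸ suc i)))))

shiftedSum : ℕ → ℕ → ℕ → ℚ
shiftedSum a l N = sumℚ (map (weight a) (compositions l N))

shiftedSum-first : ∀ a l N →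
  shiftedSum a (suc l) N ≡ ∑[ i < N ] sumℚ (map (weight a) (map (suc i ∷_) (compositions l (N ∸ suc i))))
shiftedSum-first a l N = trans (sumℚ-concatMap (weight a) (λ p → map (p ∷_) (compositions l (N ∸ p))) (applyUpTo suc N))
  (cong sumℚ (List.map-applyUpTo suc _ N))

shiftedSum-one : ∀ a N → shiftedSum a 1 N ≡ convolution δ N
shiftedSum-one a N = trans (shiftedSum-first a 0 N) (∑-cong N (λ i _ → single (suc i) (N ∸ suc i)))
  where
  single : ∀ p M → sumℚ (map (weight a) (map (p ∷_) (compositions 0 M))) ≡ ι p * δ M
  single p zero    = trans (ℚ.+-identityʳ (ι (p ℕ.* 1))) (trans (cong ι (ℕ.*-identityʳ p)) (sym (ℚ.*-identityʳ (ι p))))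
  single p (suc M) = sym (ℚ.*-zeroʳ (ι p))

shiftedSum-suc : ∀ a l N → shiftedSum a (suc (suc l)) N
  ≡ ∑[ i < N ] (ι (suc i) * inv (a ℕ.+ suc i) * inv (N ∸ suc i) * shiftedSum (a ℕ.+ suc i) (suc l) (N ∸ suc i))
shiftedSum-suc a l N = trans (shiftedSum-first a (suc l) N) (∑-cong N (λ i _ → peel (suc i) (N ∸ suc i)))
  where
  peel : ∀ p M → sumℚ (map (weight a) (map (p ∷_) (compositions (suc l) M)))
                   ≡ ι p * inv (a ℕ.+ p) * inv M * shiftedSum (a ℕ.+ p) (suc l) M
  peel p M = begin
    sumℚ (map (weight a) (map (p ∷_) cs))           ≡⟨ cong sumℚ (sym (List.map-∘ cs)) ⟩
    sumℚ (map (λ q → weight a (p ∷ q)) cs)          ≡⟨ cong sumℚ (List.map-cong-local (All.map (λ {q} (len , s) → weight-∷′ q len s) (compositions-shape (suc l) M))) ⟩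
    sumℚ (map (λ q → c * weight (a ℕ.+ p) q) cs)    ≡⟨ sumℚ-*ˡ c (weight (a ℕ.+ p)) cs ⟩
    c * shiftedSum (a ℕ.+ p) (suc l) M              ∎
    where
    cs = compositions (suc l) M
    c = ι p * inv (a ℕ.+ p) * inv M
    weight-∷′ : ∀ q → length q ≡ suc l → sum q ≡ M → weight a (p ∷ q) ≡ c * weight (a ℕ.+ p) q
    weight-∷′ (y ∷ ys) _ refl = weight-∷ a p y ys

shiftedSum-closed : ∀ l a N → shiftedSum a (suc l) N ≡ F (a ℕ.+ N) l N
shiftedSum-closed zero    a N = trans (shiftedSum-one a N) (trans (convolution-δ N) (sym (F-degree-zero N (ℕ.m≤n+m N a))))
shiftedSum-closed (suc l) a N = trans (shiftedSum-suc a l N) (trans (∑-cong N term) (convolution-H n l N (ℕ.m≤n+m N a)))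
  where
  n = a ℕ.+ N
  term : ∀ i → i < N → ι (suc i) * inv (a ℕ.+ suc i) * inv (N ∸ suc i) * shiftedSum (a ℕ.+ suc i) (suc l) (N ∸ suc i)
                         ≡ ι (suc i) * H n l (N ∸ suc i)
  term i i<N = begin
    ι (suc i) * inv (a ℕ.+ suc i) * inv r * shiftedSum (a ℕ.+ suc i) (suc l) r
      ≡⟨ cong₂ (λ u v → ι (suc i) * inv u * inv r * v) left-end (trans (shiftedSum-closed l (a ℕ.+ suc i) r) (cong (λ m → F m l r) total)) ⟩
    ι (suc i) * inv (n ∸ r) * inv r * F n l r
      ≡⟨ regroup (ι (suc i)) (inv (n ∸ r)) (inv r) (F n l r) ⟩
    ι (suc i) * H n l r ∎
    where
    r = N ∸ suc i
    total : a ℕ.+ suc i ℕ.+ r ≡ n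
    total = trans (ℕ.+-assoc a (suc i) r) (cong (a ℕ.+_) (ℕ.m+[n∸m]≡n i<N))
    left-end : a ℕ.+ suc i ≡ n ∸ r
    left-end = sym (trans (ℕ.+-∸-assoc a (ℕ.m∸n≤m N (suc i))) (cong (a ℕ.+_) (ℕ.m∸[m∸n]≡n i<N)))
    regroup : ∀ x u v w → x * u * v * w ≡ x * (u * v * w)
    regroup = solve-∀ ℚ-ring

LHS≡shiftedSum : ∀ n l → LHS n l ≡ inv n * inv n * shiftedSum 0 l n
LHS≡shiftedSum n l = trans (cong sumℚ (List.map-cong (summand≡weight n) (compositions l n)))
  (sumℚ-*ˡ (inv n * inv n) (weight 0) (compositions l n))

mainTheorem2 : (n l : ℕ) → 1 ≤ n → 1 ≤ l → l ≤ n → LHS n l ≡ RHS n l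
mainTheorem2 (suc n′) (suc l′) _ _ _ = begin
  LHS n (suc l′)                          ≡⟨ LHS≡shiftedSum n (suc l′) ⟩
  inv n * inv n * shiftedSum 0 (suc l′) n ≡⟨ cong (inv n * inv n *_) (trans (shiftedSum-closed l′ 0 n) (F-at-n n l′)) ⟩
  inv n * inv n * (ι n * σ l′ n)          ≡⟨ regroup (inv n) (ι n) (σ l′ n) ⟩
  inv n * (σ l′ n * (ι n * inv n))        ≡⟨ cong (λ x → inv n * (σ l′ n * x)) (ι*inv≡1 n (s≤s z≤n)) ⟩
  inv n * (σ l′ n * 1ℚ)                   ≡⟨ cong (inv n *_) (ℚ.*-identityʳ (σ l′ n)) ⟩
  RHS n (suc l′)                          ∎
  where
  n = suc n′
  regroup : ∀ a x s → a * a * (x * s) ≡ a * (s * (x * a))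
  regroup = solve-∀ ℚ-ring
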